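{- Let $G=(C\cup I,E)$ be a connected split graph, where $C$ induces an inclusion-maximal clique and $I$ induces an independent set. Then $|C|-1\le h(G)\le mh(G)\le |C|$.
   Context: Hunters and Rabbit game on a graph $G=(V,E)$. A hunter strategy is a finite sequence $(S_1,\dots,S_\ell)$ of non-empty subsets of $V$, using $\max_i|S_i|$ hunters. A rabbit trajectory is a walk $(r_0,\dots,r_\ell)$ in $G$ ($r_i\in N(r_{i-1})$); the strategy is winning if every rabbit trajectory has some $j<\ell$ with $r_j\in S_{j+1}$. $h(G)$ is the minimum number of hunters of a winning hunter strategy ($0$ for a single vertex). Contaminated sets: $Z_0=V$, $Z_i=\{x : \exists y\in Z_{i-1}\setminus S_i,\ xy\in E\}$. A vertex $v$ is cleared at round $i$ if $v\in S_i$, or $N(v)\cap Z_{i-1}\ne\emptyset$ and $N(v)\cap Z_{i-1}\subseteq S_i$. A strategy is monotone if any vertex $v$ cleared at some round $i$ satisfies $v\in S_{j+1}$ whenever $j>i$ and $v\in Z_j$. $mh(G)$ is the minimum number of hunters of a monotone winning hunter strategy ($0$ for a single vertex). -}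

module Defs where

open import Data.Nat using (ℕ; zero; suc; _≤_; _<_; _⊔_; _∸_)
open import Data.Fin using (Fin; zero; suc; toℕ; inject₁; fromℕ)
open import Data.Fin.Subset using (Subset) renaming (⊤ to ⊤ₛ)
open import Data.Fin.Subset using (_∈_; _∉_; _⊆_; ∣_∣; Nonempty)
open import Data.Bool using (Bool; true; false)
open import Data.Product using (Σ; ∃; _×_; _,_)
open import Data.Sum using (_⊎_)
open import Data.Empty using (⊥)
open import Data.Unit using (⊤)
open import Relation.Binary.PropositionalEquality using (_≡_; _≢_)
open import Relation.Nullary using (¬_)

record Graph : Set where
  field
    n      : ℕ
    adj    : Fin n → Fin n → Bool
    sym    : ∀ x y → adj x y ≡ adj y x
    irrefl : ∀ x → adj x x ≡ false
open Graph public

Adj : (G : Graph) → Fin (n G) → Fin (n G) → Set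
Adj G x y = adj G x y ≡ true

IsWalk : (G : Graph) {ℓ : ℕ} → (Fin (suc ℓ) → Fin (n G)) → Set
IsWalk G {ℓ} r = ∀ (i : Fin ℓ) → Adj G (r (inject₁ i)) (r (suc i))

Connected : Graph → Set
Connected G = (Σ (Fin (n G)) λ _ → ⊤) ×
  (∀ u v → Σ ℕ λ m → Σ (Fin (suc m) → Fin (n G)) λ p →
     IsWalk G p × p zero ≡ u × p (fromℕ m) ≡ v)

IsClique : (G : Graph) → Subset (n G) → Set
IsClique G C = ∀ x y → x ∈ C → y ∈ C → x ≢ y → Adj G x y

IsMaximalClique : (G : Graph) → Subset (n G) → Set
IsMaximalClique G C = IsClique G C × (∀ C' → IsClique G C' → C ⊆ C' → C' ⊆ C)

IsIndependent : (G : Graph) → Subset (n G) → Set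
IsIndependent G I = ∀ x y → x ∈ I → y ∈ I → ¬ Adj G x y

IsPartition : (G : Graph) → Subset (n G) → Subset (n G) → Set
IsPartition G C I = ∀ x → (x ∈ C ⊎ x ∈ I) × ¬ (x ∈ C × x ∈ I)

-- A hunter strategy (S_1 , … , S_ℓ); S k (k : Fin ℓ) is S_{k+1}.
record Strategy (G : Graph) : Set where
  field
    len      : ℕ
    S        : Fin len → Subset (n G)
    nonempty : ∀ k → Nonempty (S k)
open Strategy public

maxOver : {ℓ : ℕ} → (Fin ℓ → ℕ) → ℕ
maxOver {zero} f = 0
maxOver {suc ℓ} f = f zero ⊔ maxOver (λ k → f (suc k))

hunters : {G : Graph} → Strategy G → ℕ
hunters σ = maxOver (λ k → ∣ S σ k ∣)

Winning : {G : Graph} → Strategy G → Set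
Winning {G} σ = ∀ (r : Fin (suc (len σ)) → Fin (n G)) → IsWalk G r →
  Σ (Fin (len σ)) λ j → r (inject₁ j) ∈ S σ j

-- S_{i+1} indexed by a natural number i (only used for i < ℓ; default irrelevant)
atℕ : {A : Set} {ℓ : ℕ} → (Fin ℓ → A) → A → ℕ → A
atℕ {ℓ = zero} f d i = d
atℕ {ℓ = suc ℓ} f d zero = f zero
atℕ {ℓ = suc ℓ} f d (suc i) = atℕ (λ k → f (suc k)) d i

Zℕ : {G : Graph} (σ : Strategy G) → ℕ → Fin (n G) → Set
Zℕ σ zero x = ⊤
Zℕ {G} σ (suc i) x = Σ (Fin (n G)) λ y →
  Zℕ σ i y × y ∉ atℕ (S σ) ⊤ₛ i × Adj G x y

Z : {G : Graph} (σ : Strategy G) → Fin (suc (len σ)) → Fin (n G) → Set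
Z σ i = Zℕ σ (toℕ i)

-- v cleared at round k+1 (k : Fin ℓ)
Cleared : {G : Graph} (σ : Strategy G) → Fin (len σ) → Fin (n G) → Set
Cleared {G} σ k v = v ∈ S σ k ⊎
  ((Σ (Fin (n G)) λ u → Adj G v u × Z σ (inject₁ k) u) ×
   (∀ u → Adj G v u → Z σ (inject₁ k) u → u ∈ S σ k))

-- cleared at round i=k+1, j>i (j = toℕ j', j < ℓ), v ∈ Z_j ⇒ v ∈ S_{j+1}
Monotone : {G : Graph} → Strategy G → Set
Monotone {G} σ = ∀ (v : Fin (n G)) (k j : Fin (len σ)) → Cleared σ k v →
  suc (toℕ k) < toℕ j → Z σ (inject₁ j) v → v ∈ S σ j

IsHunterNumber : Graph → ℕ → Set
IsHunterNumber G k = (n G ≡ 1 × k ≡ 0) ⊎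
  (¬ (n G ≡ 1) ×
   (Σ (Strategy G) λ σ → Winning σ × hunters σ ≡ k) ×
   (∀ (σ : Strategy G) → Winning σ → k ≤ hunters σ))

IsMonotoneHunterNumber : Graph → ℕ → Set
IsMonotoneHunterNumber G k = (n G ≡ 1 × k ≡ 0) ⊎
  (¬ (n G ≡ 1) ×
   (Σ (Strategy G) λ σ → Winning σ × Monotone σ × hunters σ ≡ k) ×
   (∀ (σ : Strategy G) → Winning σ → Monotone σ → k ≤ hunters σ))

{-# OPTIONS --safe #-}
-- While at most |C| - 2 hunters shoot in a round, some vertex of the clique C is neither shot at
-- nor the rabbit's current position, so a rabbit moving inside C escapes forever: h(G) ≥ |C| - 1.
-- Shooting at C twice is a monotone winning strategy, since a rabbit outside C sits in the
-- independent set I and must step into C. As h and mh are exact minima, one must also decide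
-- whether |C| - 1 hunters suffice. A strategy wins iff its last contaminated set is empty, so
-- tracking the contaminated set together with the vertices cleared in the last round and before
-- it turns (monotone) winning strategies with k hunters into paths to an empty contaminated set in
-- a finite transition system; a shortest such path repeats no state, which bounds the search.
module Submission where

open import Data.Bool using (true; false)
open import Data.Fin using (Fin; zero; suc)
open import Data.Fin.Subset using (Subset; ∣_∣; Nonempty; ⁅_⁆)
open import Data.Fin.Subset.Properties using (nonempty?; ∣p∣≤n; x∈⁅x⁆; x∈⁅y⁆⇒x≡y)
open import Data.Nat using (ℕ; zero; suc; _≤_; _<_; _∸_; _⊔_; z≤n; s≤s; _≟_)
open import Data.Nat.Properties using (≤-refl; ≤-antisym; ≮⇒≥; m∸n≤m; ∸-monoˡ-≤; ⊔-identityʳ; ⊔-idem)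
open import Data.Product using (Σ; ∃; _×_; _,_; proj₁)
open import Data.Sum using (inj₁; inj₂)
open import Data.Empty using (⊥-elim)
open import Relation.Binary.PropositionalEquality using (_≡_; refl; sym; trans; cong; subst)
open import Relation.Nullary using (Dec; yes; no; ¬_)
open import Defs hiding (sym)

module FiniteSubsets where
  open import Data.Bool using (true; false)
  open import Data.Fin using (Fin)
  open import Data.Fin.Properties using (any?)
  open import Data.Fin.Subset using (Subset; _∈_; _∉_; _⊆_; _∪_; ∣_∣; inside; outside)
  open import Data.Fin.Subset.Properties using (_∈?_; p⊆q⇒∣p∣≤∣q∣)
  open import Data.List as List using (List; cartesianProductWith)
  import Data.List.Membership.Propositional as List
  open import Data.List.Membership.Propositional.Properties using (∈-cartesianProductWith⁺)
  open import Data.List.Relation.Unary.Any using (here; there)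
  open import Data.Nat using (zero; suc; _≤_; _<_; _+_; z≤n; s≤s)
  open import Data.Nat.Properties using (≤-trans; n≤1+n; +-suc; <⇒≱)
  open import Data.Product using (∃; _×_; _,_)
  open import Data.Empty using (⊥-elim)
  open import Data.Vec using ([]; _∷_; tabulate)
  open import Data.Vec.Properties using (lookup∘tabulate; []=⇒lookup; lookup⇒[]=)
  open import Function.Bundles using (_⇔_; mk⇔)
  open import Relation.Binary.PropositionalEquality using (_≡_; refl; sym; trans; subst)
  open import Relation.Nullary using (Dec; yes; no; does)
  open import Relation.Nullary.Decidable using (_×-dec_; ¬?; dec-true; decidable-stable)

  allSubsets : ∀ n → List (Subset n)
  allSubsets zero = List.[ [] ]
  allSubsets (suc n) = cartesianProductWith _∷_ (inside List.∷ List.[ outside ]) (allSubsets n)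

  ∈-allSubsets : ∀ {n} (p : Subset n) → p List.∈ allSubsets n
  ∈-allSubsets [] = here refl
  ∈-allSubsets (b ∷ p) = ∈-cartesianProductWith⁺ _∷_ {xs = inside List.∷ List.[ outside ]} (bit b) (∈-allSubsets p)
    where
    bit : ∀ b → b List.∈ inside List.∷ List.[ outside ]
    bit true = here refl
    bit false = there (here refl)

  subset : ∀ {n} {P : Fin n → Set} → (∀ x → Dec (P x)) → Subset n
  subset P? = tabulate (λ x → does (P? x))

  ∈-subset : ∀ {n} {P : Fin n → Set} (P? : ∀ x → Dec (P x)) {x} → x ∈ subset P? ⇔ P x
  ∈-subset {P = P} P? {x} = mk⇔ to (λ px → lookup⇒[]= x _ (trans (lookup∘tabulate _ x) (dec-true (P? x) px)))
    where
    does-true : (d : Dec (P x)) → does d ≡ true → P x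
    does-true (yes px) _ = px
    to : x ∈ subset P? → P x
    to x∈ = does-true (P? x) (trans (sym (lookup∘tabulate _ x)) ([]=⇒lookup x∈))

  ∣p∪q∣≤∣p∣+∣q∣ : ∀ {n} (p q : Subset n) → ∣ p ∪ q ∣ ≤ ∣ p ∣ + ∣ q ∣
  ∣p∪q∣≤∣p∣+∣q∣ [] [] = z≤n
  ∣p∪q∣≤∣p∣+∣q∣ (true ∷ p) (true ∷ q) =
    s≤s (≤-trans (∣p∪q∣≤∣p∣+∣q∣ p q) (subst (∣ p ∣ + ∣ q ∣ ≤_) (sym (+-suc ∣ p ∣ ∣ q ∣)) (n≤1+n _)))
  ∣p∪q∣≤∣p∣+∣q∣ (true ∷ p) (false ∷ q) = s≤s (∣p∪q∣≤∣p∣+∣q∣ p q)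
  ∣p∪q∣≤∣p∣+∣q∣ (false ∷ p) (true ∷ q) = subst (suc ∣ p ∪ q ∣ ≤_) (sym (+-suc ∣ p ∣ ∣ q ∣)) (s≤s (∣p∪q∣≤∣p∣+∣q∣ p q))
  ∣p∪q∣≤∣p∣+∣q∣ (false ∷ p) (false ∷ q) = ∣p∪q∣≤∣p∣+∣q∣ p q

  ∣p∣<∣q∣⇒∃∈q∉p : ∀ {n} {p q : Subset n} → ∣ p ∣ < ∣ q ∣ → ∃ λ x → x ∈ q × x ∉ p
  ∣p∣<∣q∣⇒∃∈q∉p {p = p} {q} ∣p∣<∣q∣ with any? (λ x → x ∈? q ×-dec ¬? (x ∈? p))
  ... | yes found = found
  ... | no none = ⊥-elim (<⇒≱ ∣p∣<∣q∣ (p⊆q⇒∣p∣≤∣q∣ q⊆p))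
    where
    q⊆p : q ⊆ p
    q⊆p {x} x∈q = decidable-stable (x ∈? p) (λ x∉p → none (x , x∈q , x∉p))

module Indexing where
  open import Data.Fin using (Fin; zero; suc; toℕ; fromℕ<)
  open import Data.Fin.Properties using (toℕ<n; toℕ-fromℕ<)
  open import Data.Nat using (ℕ; zero; suc; _≤_; _<_; z≤n)
  open import Data.Nat.Properties using (≤-trans; ⊔-lub; m≤m⊔n; m≤n⊔m)
  open import Function.Bundles using (_⇔_; mk⇔)
  open import Relation.Binary.PropositionalEquality using (_≡_; refl; subst)
  open import Defs using (atℕ; maxOver)

  atℕ-toℕ : ∀ {A : Set} {ℓ} (F : Fin ℓ → A) d (j : Fin ℓ) → atℕ F d (toℕ j) ≡ F j
  atℕ-toℕ F d zero = refl
  atℕ-toℕ F d (suc j) = atℕ-toℕ (λ k → F (suc k)) d j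

  atℕ-preserves : ∀ {A : Set} {ℓ} (P : A → Set) {F : Fin ℓ → A} {d} →
                  (∀ j → P (F j)) → P d → ∀ i → P (atℕ F d i)
  atℕ-preserves {ℓ = zero} P _ Pd i = Pd
  atℕ-preserves {ℓ = suc ℓ} P PF Pd zero = PF zero
  atℕ-preserves {ℓ = suc ℓ} P PF Pd (suc i) = atℕ-preserves P (λ j → PF (suc j)) Pd i

  maxOver-≤⇔ : ∀ {ℓ} (f : Fin ℓ → ℕ) {k} → maxOver f ≤ k ⇔ (∀ j → f j ≤ k)
  maxOver-≤⇔ f = mk⇔ (to f) (from f)
    where
    to : ∀ {ℓ} (f : Fin ℓ → ℕ) {k} → maxOver f ≤ k → ∀ j → f j ≤ k
    to f ≤k zero = ≤-trans (m≤m⊔n _ _) ≤k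
    to f ≤k (suc j) = to (λ i → f (suc i)) (≤-trans (m≤n⊔m _ _) ≤k) j
    from : ∀ {ℓ} (f : Fin ℓ → ℕ) {k} → (∀ j → f j ≤ k) → maxOver f ≤ k
    from {zero} f _ = z≤n
    from {suc ℓ} f ≤k = ⊔-lub (≤k zero) (from (λ i → f (suc i)) (λ j → ≤k (suc j)))

  ∀<⇔∀Fin : ∀ {ℓ} (P : ℕ → Set) → (∀ m → m < ℓ → P m) ⇔ (∀ (j : Fin ℓ) → P (toℕ j))
  ∀<⇔∀Fin P = mk⇔ (λ P< j → P< (toℕ j) (toℕ<n j))
                  (λ PFin m m<ℓ → subst P (toℕ-fromℕ< m<ℓ) (PFin (fromℕ< m<ℓ)))

module FiniteSearch where
  open import Data.Fin using (Fin; zero; suc; toℕ)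
  open import Data.Fin.Properties using (pigeonhole)
  open import Data.List using (List; []; _∷_; length; lookup; tabulate)
  open import Data.List.Membership.Propositional using (_∈_)
  open import Data.List.Membership.Propositional.Properties using (∈-lookup)
  import Data.List.Membership.DecPropositional as DecMembership
  import Data.List.Relation.Unary.All as All
  open import Data.List.Relation.Unary.All.Properties using (¬Any⇒All¬)
  open import Data.List.Relation.Unary.Any using (here; there; index)
  open import Data.List.Relation.Unary.Any.Properties using (lookup-index)
  open import Data.List.Relation.Unary.Unique.Propositional using (Unique; []; _∷_)
  open import Data.Nat using (ℕ; zero; suc; _≤_; _<_; z≤n; s≤s; _≤?_)
  open import Data.Nat.Properties using (≰⇒>; <⇒≤)
  open import Data.Product using (∃; _×_; _,_; proj₂)
  open import Data.Product.Function.NonDependent.Propositional using (_×-⇔_)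
  open import Data.Sum using (_⊎_; inj₁; inj₂; [_,_])
  open import Data.Empty using (⊥-elim)
  open import Function using (_∘_)
  open import Function.Bundles using (_⇔_; mk⇔)
  import Function.Properties.Equivalence as ⇔
  open import Relation.Binary.Definitions using (DecidableEquality)
  open import Relation.Binary.PropositionalEquality using (_≡_; _≢_; refl; sym; trans; cong; subst)
  open import Relation.Nullary using (Dec; yes; no)
  open import Relation.Nullary.Decidable using (map′; _×-dec_; _⊎-dec_)
  open import Defs using (atℕ)

  unique-lookup : ∀ {A : Set} {xs : List A} → Unique xs →
                  ∀ {i j} → toℕ i < toℕ j → lookup xs i ≢ lookup xs j
  unique-lookup (x∉xs ∷ _) {zero} {suc j} _ = All.lookup x∉xs (∈-lookup j)
  unique-lookup (_ ∷ xs!) {suc i} {suc j} (s≤s i<j) = unique-lookup xs! i<j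

  run : ∀ {St L : Set} → (St → L → St) → St → (ℕ → L) → ℕ → St
  run step s f zero = s
  run step s f (suc m) = step (run step s f m) (f m)

  run-suc : ∀ {St L : Set} (step : St → L → St) s f m →
            run step s f (suc m) ≡ run step (step s (f 0)) (f ∘ suc) m
  run-suc step s f zero = refl
  run-suc step s f (suc m) = cong (λ t → step t (f (suc m))) (run-suc step s f m)

  module Reachability
    {St L : Set} (_≟_ : DecidableEquality St)
    (states : List St) (∈-states : ∀ s → s ∈ states)
    (any-move? : ∀ {P : L → Set} → (∀ l → Dec (P l)) → Dec (∃ P))
    (step : St → L → St)
    {Allowed : St → L → Set} (allowed? : ∀ s l → Dec (Allowed s l))
    {Final : St → Set} (final? : ∀ s → Dec (Final s)) where

    open DecMembership _≟_ using (_∈?_)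

    Path : St → List L → Set
    Path s [] = Final s
    Path s (l ∷ ls) = Allowed s l × Path (step s l) ls

    visited : St → List L → List St
    visited s [] = s ∷ []
    visited s (l ∷ ls) = s ∷ visited (step s l) ls

    length-visited : ∀ s ls → length (visited s ls) ≡ suc (length ls)
    length-visited s [] = refl
    length-visited s (l ∷ ls) = cong suc (length-visited (step s l) ls)

    unique⇒length≤ : ∀ {xs} → Unique xs → length xs ≤ length states
    unique⇒length≤ {xs} xs! with length xs ≤? length states
    ... | yes ≤states = ≤states
    ... | no >states with pigeonhole (≰⇒> >states) (index ∘ ∈-states ∘ lookup xs)
    ...   | i , j , i<j , same = ⊥-elim (unique-lookup xs! i<j (same-index⇒same i j same))
      where
      same-index⇒same : ∀ i j → index (∈-states (lookup xs i)) ≡ index (∈-states (lookup xs j)) →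
                        lookup xs i ≡ lookup xs j
      same-index⇒same i j eq = trans (lookup-index (∈-states _))
                          (trans (cong (lookup states) eq) (sym (lookup-index (∈-states _))))

    resume : ∀ {s s'} ls → s ∈ visited s' ls → Path s' ls → Unique (visited s' ls) →
             ∃ λ ls' → Path s ls' × Unique (visited s ls')
    resume [] (here refl) p u = [] , p , u
    resume (l ∷ ls) (here refl) p u = l ∷ ls , p , u
    resume (l ∷ ls) (there s∈) (_ , p) (_ ∷ u) = resume ls s∈ p u

    prune : ∀ {s} ls → Path s ls → ∃ λ ls' → Path s ls' × Unique (visited s ls')
    prune [] p = [] , p , All.[] ∷ []
    prune {s} (l ∷ ls) (a , p) with prune ls p
    ... | ls' , p' , u' with s ∈? visited (step s l) ls'
    ... | yes s∈ = resume ls' s∈ p' u'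
    ... | no s∉ = l ∷ ls' , (a , p') , ¬Any⇒All¬ _ s∉ ∷ u'

    short-path : ∀ {s} ls → Path s ls → ∃ λ ls' → Path s ls' × length ls' < length states
    short-path {s} ls p with prune ls p
    ... | ls' , p' , u' = ls' , p' , subst (_≤ length states) (length-visited s ls') (unique⇒length≤ u')

    path-within? : ∀ m s → Dec (∃ λ ls → Path s ls × length ls ≤ m)
    path-within? zero s = map′ (λ f → [] , f , z≤n) (λ { ([] , f , _) → f ; (_ ∷ _ , _ , ()) }) (final? s)
    path-within? (suc m) s =
      map′ [ stop , go ] split (final? s ⊎-dec any-move? (λ l → allowed? s l ×-dec path-within? m (step s l)))
      where
      stop : Final s → ∃ λ ls → Path s ls × length ls ≤ suc m
      stop f = [] , f , z≤n
      go : (∃ λ l → Allowed s l × ∃ λ ls → Path (step s l) ls × length ls ≤ m) →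
           ∃ λ ls → Path s ls × length ls ≤ suc m
      go (l , a , ls , p , ≤m) = l ∷ ls , (a , p) , s≤s ≤m
      split : (∃ λ ls → Path s ls × length ls ≤ suc m) →
              Final s ⊎ (∃ λ l → Allowed s l × ∃ λ ls → Path (step s l) ls × length ls ≤ m)
      split ([] , f , _) = inj₁ f
      split (l ∷ ls , (a , p) , s≤s ≤m) = inj₂ (l , a , ls , p , ≤m)

    path? : ∀ s → Dec (∃ (Path s))
    path? s = map′ (λ (ls , p , _) → ls , p) (λ (ls , p) → weaken (short-path ls p))
                   (path-within? (length states) s)
      where
      weaken : (∃ λ ls → Path s ls × length ls < length states) → ∃ λ ls → Path s ls × length ls ≤ length states
      weaken (ls , p , <states) = ls , p , <⇒≤ <states

    IndexedPath : St → ℕ → (ℕ → L) → Set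
    IndexedPath s ℓ f = (∀ m → m < ℓ → Allowed (run step s f m) (f m)) × Final (run step s f ℓ)

    IndexedPath-suc : ∀ s ℓ f →
      IndexedPath s (suc ℓ) f ⇔ (Allowed s (f 0) × IndexedPath (step s (f 0)) ℓ (f ∘ suc))
    IndexedPath-suc s ℓ f = mk⇔ to from
      where
      to : IndexedPath s (suc ℓ) f → Allowed s (f 0) × IndexedPath (step s (f 0)) ℓ (f ∘ suc)
      to (allowed , final) =
        allowed 0 (s≤s z≤n) ,
        (λ m m<ℓ → subst (λ t → Allowed t (f (suc m))) (run-suc step s f m) (allowed (suc m) (s≤s m<ℓ))) ,
        subst Final (run-suc step s f ℓ) final
      from : Allowed s (f 0) × IndexedPath (step s (f 0)) ℓ (f ∘ suc) → IndexedPath s (suc ℓ) f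
      from (allowed₀ , allowed , final) = allowed′ , subst Final (sym (run-suc step s f ℓ)) final
        where
        allowed′ : ∀ m → m < suc ℓ → Allowed (run step s f m) (f m)
        allowed′ zero _ = allowed₀
        allowed′ (suc m) (s≤s m<ℓ) =
          subst (λ t → Allowed t (f (suc m))) (sym (run-suc step s f m)) (allowed m m<ℓ)

    Path-tabulate⇔IndexedPath : ∀ s {ℓ} (F : Fin ℓ → L) d →
                                Path s (tabulate F) ⇔ IndexedPath s ℓ (atℕ F d)
    Path-tabulate⇔IndexedPath s {zero} F d = mk⇔ (λ final → (λ _ ()) , final) proj₂
    Path-tabulate⇔IndexedPath s {suc ℓ} F d =
      ⇔.trans (⇔.refl ×-⇔ Path-tabulate⇔IndexedPath (step s (F zero)) (F ∘ suc) d)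
              (⇔.sym (IndexedPath-suc s ℓ (atℕ F d)))

module Hunting where
  open import Data.Bool using (true) renaming (_≟_ to _≟ᵇ_)
  open import Data.Fin using (Fin; zero; suc; toℕ; inject₁; fromℕ)
  open import Data.Fin.Properties using (toℕ-inject₁; toℕ-fromℕ; toℕ<n; any?)
  open import Data.Fin.Subset using (Subset; _∈_; _∉_; _∪_; ∣_∣; ⁅_⁆) renaming (⊥ to ∅; ⊤ to full)
  open import Data.Fin.Subset.Properties using (_∈?_; x∈⁅x⁆; x∈p∪q⁺; ∣⊥∣≡0; ∣⁅x⁆∣≡1)
  open import Data.Nat using (ℕ; zero; suc; _≤_; _<_; _+_; _∸_; _≤?_; z≤n; s≤s)
  open import Data.Nat.Properties
    using (≤-trans; ≤-refl; ≤-<-trans; +-suc; +-identityʳ; +-comm; suc-injective; ≰⇒>; <⇒≱;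
           m≤n⇒m≤o+n; n≤1+n; ∸-monoˡ-≤; module ≤-Reasoning)
  open import Data.Product using (∃; _×_; _,_; proj₁; proj₂)
  open import Data.Sum using (inj₁; inj₂)
  open import Data.Unit using (tt)
  open import Data.Empty using (⊥-elim)
  open import Function.Bundles using (_⇔_; mk⇔; Equivalence)
  open import Relation.Binary.PropositionalEquality using (_≡_; _≢_; sym; trans; cong; subst)
  open import Relation.Nullary using (Dec; yes; no; ¬_)
  open import Defs hiding (sym)

  open FiniteSubsets
  open Indexing

  Adj? : (G : Graph) → ∀ x y → Dec (Adj G x y)
  Adj? G x y = adj G x y ≟ᵇ true

  Adj-sym : (G : Graph) → ∀ {x y} → Adj G x y → Adj G y x
  Adj-sym G {x} {y} xy = trans (Graph.sym G y x) xy

  moves : {G : Graph} → Strategy G → ℕ → Subset (n G)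
  moves σ = atℕ (S σ) full

  moves-toℕ : {G : Graph} (σ : Strategy G) (j : Fin (len σ)) → moves σ (toℕ j) ≡ S σ j
  moves-toℕ σ = atℕ-toℕ (S σ) full

  module Contamination {G : Graph} (σ : Strategy G) where

    ℓ : ℕ
    ℓ = len σ

    Escapes : (ℕ → Fin (n G)) → Set
    Escapes u = ∀ (j : Fin ℓ) → u (toℕ j) ∉ S σ j × Adj G (u (toℕ j)) (u (suc (toℕ j)))

    escaping⇒losing : ∀ u → Escapes u → ¬ Winning σ
    escaping⇒losing u escapes win with win (λ j → u (toℕ j)) walk
      where
      walk : IsWalk G (λ j → u (toℕ j))
      walk i = subst (λ t → Adj G (u t) (u (suc (toℕ i)))) (sym (toℕ-inject₁ i)) (proj₂ (escapes i))
    ... | j , hit = proj₁ (escapes j) (subst (λ t → u t ∈ S σ j) (toℕ-inject₁ j) hit)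

    avoiding-walk-contaminated : ∀ r → IsWalk G r → (∀ j → r (inject₁ j) ∉ S σ j) →
                                 ∀ m (j : Fin (suc ℓ)) → toℕ j ≡ m → Zℕ σ m (r j)
    avoiding-walk-contaminated r walk avoids zero j _ = tt
    avoiding-walk-contaminated r walk avoids (suc m) (suc j) j+1≡m+1 =
      r (inject₁ j) ,
      avoiding-walk-contaminated r walk avoids m (inject₁ j) (trans (toℕ-inject₁ j) j≡m) ,
      subst (r (inject₁ j) ∉_) (trans (sym (moves-toℕ σ j)) (cong (moves σ) j≡m)) (avoids j) ,
      Adj-sym G (walk j)
      where
      j≡m : toℕ j ≡ m
      j≡m = suc-injective j+1≡m+1

    -- The walk u is followed from round m on: u t is its position in round t + m.
    EvadesFrom : ℕ → (ℕ → Fin (n G)) → Set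
    EvadesFrom m u = ∀ t → t + m < ℓ → u t ∉ moves σ (t + m) × Adj G (u t) (u (suc t))

    contaminated⇒evading : ∀ m u → Zℕ σ m (u 0) → EvadesFrom m u → ∃ (EvadesFrom 0)
    contaminated⇒evading zero u _ evades = u , evades
    contaminated⇒evading (suc m) u (y , z , y∉ , adj) evades = contaminated⇒evading m u′ z evades′
      where
      u′ : ℕ → Fin (n G)
      u′ zero = y
      u′ (suc t) = u t
      evades′ : EvadesFrom m u′
      evades′ zero _ = y∉ , Adj-sym G adj
      evades′ (suc t) = subst (λ i → i < ℓ → u t ∉ moves σ i × Adj G (u t) (u (suc t))) (+-suc t m) (evades t)

    evading⇒escaping : ∀ u → EvadesFrom 0 u → Escapes u
    evading⇒escaping u evades j with evades (toℕ j) (subst (_< ℓ) (sym (+-identityʳ (toℕ j))) (toℕ<n j))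
    ... | u∉ , adj = subst (u (toℕ j) ∉_) (trans (cong (moves σ) (+-identityʳ (toℕ j))) (moves-toℕ σ j)) u∉ , adj

    winning⇔uncontaminated : Winning σ ⇔ (∀ x → ¬ Zℕ σ ℓ x)
    winning⇔uncontaminated = mk⇔ to from
      where
      to : Winning σ → ∀ x → ¬ Zℕ σ ℓ x
      to win x z with contaminated⇒evading ℓ (λ _ → x) z (λ t t+ℓ<ℓ → ⊥-elim (<⇒≱ t+ℓ<ℓ (m≤n⇒m≤o+n t ≤-refl)))
      ... | u , evades = escaping⇒losing u (evading⇒escaping u evades) win
      from : (∀ x → ¬ Zℕ σ ℓ x) → Winning σ
      from clean r walk with any? (λ j → r (inject₁ j) ∈? S σ j)
      ... | yes hit = hit
      ... | no miss = ⊥-elim (clean (r (fromℕ ℓ))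
                        (avoiding-walk-contaminated r walk (λ j r∈ → miss (j , r∈)) ℓ (fromℕ ℓ) (toℕ-fromℕ ℓ)))

  clique-escape : ∀ {G} {K : Subset (n G)} {h} → IsClique G K → suc h < ∣ K ∣ →
                  (H : ℕ → Subset (n G)) → (∀ i → ∣ H i ∣ ≤ h) →
                  ∃ λ (w : ℕ → Fin (n G)) → ∀ i → w i ∉ H i × Adj G (w i) (w (suc i))
  clique-escape {G} {K} {h} clique h+1<∣K∣ H ∣H∣≤h =
    w , λ i → w∉H i , clique _ _ (w∈K i) (w∈K (suc i)) (w-moves i)
    where
    room : ∀ {X} → ∣ X ∣ ≤ suc h → ∃ λ x → x ∈ K × x ∉ X
    room ∣X∣≤ = ∣p∣<∣q∣⇒∃∈q∉p (≤-<-trans ∣X∣≤ h+1<∣K∣)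
    ∣H∪x∣≤ : ∀ i x → ∣ H i ∪ ⁅ x ⁆ ∣ ≤ suc h
    ∣H∪x∣≤ i x = begin
      ∣ H i ∪ ⁅ x ⁆ ∣     ≤⟨ ∣p∪q∣≤∣p∣+∣q∣ (H i) ⁅ x ⁆ ⟩
      ∣ H i ∣ + ∣ ⁅ x ⁆ ∣ ≡⟨ cong (∣ H i ∣ +_) (∣⁅x⁆∣≡1 x) ⟩
      ∣ H i ∣ + 1         ≡⟨ +-comm ∣ H i ∣ 1 ⟩
      suc ∣ H i ∣         ≤⟨ s≤s (∣H∣≤h i) ⟩
      suc h               ∎
      where open ≤-Reasoning
    first : ∃ λ x → x ∈ K × x ∉ H 0
    first = room (≤-trans (∣H∣≤h 0) (n≤1+n h))
    hop : ∀ i x → ∃ λ y → y ∈ K × y ∉ H i ∪ ⁅ x ⁆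
    hop i x = room (∣H∪x∣≤ i x)
    w : ℕ → Fin (n G)
    w zero = proj₁ first
    w (suc i) = proj₁ (hop (suc i) (w i))
    w∈K : ∀ i → w i ∈ K
    w∈K zero = proj₁ (proj₂ first)
    w∈K (suc i) = proj₁ (proj₂ (hop (suc i) (w i)))
    w∉H : ∀ i → w i ∉ H i
    w∉H zero = proj₂ (proj₂ first)
    w∉H (suc i) w∈H = proj₂ (proj₂ (hop (suc i) (w i))) (x∈p∪q⁺ (inj₁ w∈H))
    w-moves : ∀ i → w i ≢ w (suc i)
    w-moves i same = proj₂ (proj₂ (hop (suc i) (w i))) (x∈p∪q⁺ (inj₂ (subst (_∈ ⁅ w i ⁆) same (x∈⁅x⁆ (w i)))))

  ∣atℕ-S∣≤hunters : ∀ {G} (σ : Strategy G) i → ∣ atℕ (S σ) ∅ i ∣ ≤ hunters σ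
  ∣atℕ-S∣≤hunters {G} σ = atℕ-preserves (λ X → ∣ X ∣ ≤ hunters σ)
    (Equivalence.to (maxOver-≤⇔ (λ j → ∣ S σ j ∣)) ≤-refl) (subst (_≤ hunters σ) (sym (∣⊥∣≡0 (n G))) z≤n)

  clique-bound : ∀ {G} {K : Subset (n G)} → IsClique G K → (σ : Strategy G) → Winning σ → ∣ K ∣ ∸ 1 ≤ hunters σ
  clique-bound {G} {K} clique σ win with ∣ K ∣ ≤? suc (hunters σ)
  ... | yes small = ∸-monoˡ-≤ 1 small
  ... | no big with clique-escape {G} clique (≰⇒> big) (atℕ (S σ) ∅) (∣atℕ-S∣≤hunters σ)
  ...   | w , evades = ⊥-elim (Contamination.escaping⇒losing σ w escapes win)
    where
    escapes : Contamination.Escapes σ w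
    escapes j = subst (w (toℕ j) ∉_) (atℕ-toℕ (S σ) ∅ j) (proj₁ (evades (toℕ j))) , proj₂ (evades (toℕ j))

module Encoding (G : Graph) where
  open import Data.Bool using (Bool; T; T?) renaming (_≟_ to _≟ᵇ_)
  open import Data.Fin using (Fin; zero; suc; toℕ; fromℕ<)
  open import Data.Fin.Properties using (toℕ-inject₁; toℕ-fromℕ<; toℕ<n; any?; all?)
  open import Data.Fin.Subset using (Subset; _∈_; _∉_; _⊆_; _∪_; _∩_; ∣_∣; Nonempty; Empty) renaming (⊥ to ∅; ⊤ to full)
  open import Data.Fin.Subset.Properties using (_∈?_; _⊆?_; nonempty?; anySubset?; ∈⊤; ∉⊥; x∈p∪q⁺; x∈p∪q⁻; x∈p∩q⁺; x∈p∩q⁻)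
  open import Data.List using (List; length; lookup; tabulate; cartesianProduct)
  import Data.List.Membership.Propositional as List
  open import Data.List.Membership.Propositional.Properties using (∈-cartesianProduct⁺)
  open import Data.List.Properties using (tabulate-lookup)
  open import Data.Nat using (ℕ; zero; suc; _≤_; _<_; _≤?_; s≤s)
  open import Data.Nat.Properties using (≤-refl; ≤-trans; <-trans; n≤1+n; n<1+n; m≤n⇒m<n∨m≡n)
  open import Data.Product using (Σ; ∃; _×_; _,_; proj₁; proj₂)
  import Data.Product.Properties as Product
  open import Data.Sum using (_⊎_; inj₁; inj₂)
  open import Data.Unit using (tt)
  open import Data.Empty using (⊥-elim)
  import Data.Vec.Properties as Vec
  open import Function.Bundles using (_⇔_; mk⇔; Equivalence)
  import Function.Properties.Equivalence as ⇔
  open import Relation.Binary.Definitions using (DecidableEquality)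
  open import Relation.Binary.PropositionalEquality using (refl; sym; subst; subst₂)
  open import Relation.Nullary using (Dec)
  open import Relation.Nullary.Decidable using (map′; _×-dec_; _⊎-dec_; _→-dec_; ¬?)
  open import Defs hiding (sym)

  open FiniteSubsets
  open Indexing
  open FiniteSearch
  open Hunting

  Spread : (Fin (n G) → Set) → Subset (n G) → Fin (n G) → Set
  Spread Z S x = Σ (Fin (n G)) λ y → Z y × y ∉ S × Adj G x y

  Clears : (Fin (n G) → Set) → Subset (n G) → Fin (n G) → Set
  Clears Z S v = v ∈ S ⊎ ((Σ (Fin (n G)) λ u → Adj G v u × Z u) × (∀ u → Adj G v u → Z u → u ∈ S))

  module _ {Z Z′ : Fin (n G) → Set} (Z⇔Z′ : ∀ {y} → Z y ⇔ Z′ y) {S : Subset (n G)} where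
    open Equivalence

    Spread-cong : ∀ {x} → Spread Z S x ⇔ Spread Z′ S x
    Spread-cong = mk⇔ (λ (y , z , y∉ , xy) → y , to Z⇔Z′ z , y∉ , xy)
                      (λ (y , z , y∉ , xy) → y , from Z⇔Z′ z , y∉ , xy)

    Clears-cong : ∀ {v} → Clears Z S v ⇔ Clears Z′ S v
    Clears-cong = mk⇔ (cong′ (to Z⇔Z′) (from Z⇔Z′)) (cong′ (from Z⇔Z′) (to Z⇔Z′))
      where
      cong′ : ∀ {A B : Fin (n G) → Set} → (∀ {u} → A u → B u) → (∀ {u} → B u → A u) →
              ∀ {v} → Clears A S v → Clears B S v
      cong′ _ _ (inj₁ v∈S) = inj₁ v∈S
      cong′ A⇒B B⇒A (inj₂ ((u , vu , a) , guarded)) =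
        inj₂ ((u , vu , A⇒B a) , λ u vu b → guarded u vu (B⇒A b))

  spread? : ∀ Z S x → Dec (Spread (_∈ Z) S x)
  spread? Z S x = any? λ y → y ∈? Z ×-dec ¬? (y ∈? S) ×-dec Adj? G x y

  clears? : ∀ Z S v → Dec (Clears (_∈ Z) S v)
  clears? Z S v = v ∈? S ⊎-dec
    (any? (λ u → Adj? G v u ×-dec u ∈? Z) ×-dec all? (λ u → Adj? G v u →-dec (u ∈? Z →-dec u ∈? S)))

  spread cleared : Subset (n G) → Subset (n G) → Subset (n G)
  spread Z S = subset (spread? Z S)
  cleared Z S = subset (clears? Z S)

  -- After m rounds: Z_m, the vertices cleared before round m, and those cleared at round m.
  State : Set
  State = Subset (n G) × Subset (n G) × Subset (n G)

  step : State → Subset (n G) → State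
  step (Z , D , P) S = spread Z S , D ∪ P , cleared Z S

  start : State
  start = full , ∅ , ∅

  module Trace (σ : Strategy G) where

    state : ℕ → State
    state = run step start (moves σ)

    contaminated clearedEarlier clearedLast : ℕ → Subset (n G)
    contaminated m = proj₁ (state m)
    clearedEarlier m = proj₁ (proj₂ (state m))
    clearedLast m = proj₂ (proj₂ (state m))

    ∈-contaminated⇔ : ∀ m {x} → x ∈ contaminated m ⇔ Zℕ σ m x
    ∈-contaminated⇔ zero = mk⇔ (λ _ → tt) (λ _ → ∈⊤)
    ∈-contaminated⇔ (suc m) = ⇔.trans (∈-subset (spread? (contaminated m) (moves σ m))) (Spread-cong (∈-contaminated⇔ m))

    ∈-clearedLast⇔ : ∀ i {v} → v ∈ clearedLast (suc i) ⇔ Clears (Zℕ σ i) (moves σ i) v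
    ∈-clearedLast⇔ i = ⇔.trans (∈-subset (clears? (contaminated i) (moves σ i))) (Clears-cong (∈-contaminated⇔ i))

    ∈-clearedEarlier⇔ : ∀ m {v} → v ∈ clearedEarlier m ⇔ ∃ λ i → suc i < m × Clears (Zℕ σ i) (moves σ i) v
    ∈-clearedEarlier⇔ m = mk⇔ (to m) (from m)
      where
      to : ∀ m {v} → v ∈ clearedEarlier m → ∃ λ i → suc i < m × Clears (Zℕ σ i) (moves σ i) v
      to zero v∈∅ = ⊥-elim (∉⊥ v∈∅)
      to (suc m) v∈ with x∈p∪q⁻ (clearedEarlier m) (clearedLast m) v∈
      ... | inj₁ early with to m early
      ...   | i , i<m , c = i , ≤-trans i<m (n≤1+n m) , c
      to (suc zero) v∈ | inj₂ v∈∅ = ⊥-elim (∉⊥ v∈∅)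
      to (suc (suc i)) v∈ | inj₂ last = i , ≤-refl , Equivalence.to (∈-clearedLast⇔ i) last
      from : ∀ m {v} → (∃ λ i → suc i < m × Clears (Zℕ σ i) (moves σ i) v) → v ∈ clearedEarlier m
      from (suc m) (i , s≤s i<m , c) with m≤n⇒m<n∨m≡n i<m
      ... | inj₁ i<m′ = x∈p∪q⁺ (inj₁ (from m (i , i<m′ , c)))
      ... | inj₂ refl = x∈p∪q⁺ (inj₂ (Equivalence.from (∈-clearedLast⇔ i) c))

    Cleared⇔Clears : ∀ (k : Fin (len σ)) {v} → Cleared σ k v ⇔ Clears (Zℕ σ (toℕ k)) (moves σ (toℕ k)) v
    Cleared⇔Clears k {v} = mk⇔ (subst₂ ClearsAt (toℕ-inject₁ k) (sym (moves-toℕ σ k)))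
                         (subst₂ ClearsAt (sym (toℕ-inject₁ k)) (moves-toℕ σ k))
      where
      ClearsAt : ℕ → Subset (n G) → Set
      ClearsAt i S = Clears (Zℕ σ i) S v

    monotone⇔ : Monotone σ ⇔ (∀ (j : Fin (len σ)) → clearedEarlier (toℕ j) ∩ contaminated (toℕ j) ⊆ S σ j)
    monotone⇔ = mk⇔ to from
      where
      to : Monotone σ → ∀ j → clearedEarlier (toℕ j) ∩ contaminated (toℕ j) ⊆ S σ j
      to mono j {v} v∈ with x∈p∩q⁻ (clearedEarlier (toℕ j)) (contaminated (toℕ j)) v∈
      ... | early , cont with Equivalence.to (∈-clearedEarlier⇔ (toℕ j)) early
      ... | i , i<j , c =
        mono v (fromℕ< i<ℓ) j
          (Equivalence.from (Cleared⇔Clears (fromℕ< i<ℓ)) (subst (λ t → Clears (Zℕ σ t) (moves σ t) v) (sym (toℕ-fromℕ< i<ℓ)) c))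
          (subst (λ t → suc t < toℕ j) (sym (toℕ-fromℕ< i<ℓ)) i<j)
          (subst (λ t → Zℕ σ t v) (sym (toℕ-inject₁ j)) (Equivalence.to (∈-contaminated⇔ (toℕ j)) cont))
        where
        i<ℓ : i < len σ
        i<ℓ = <-trans (n<1+n i) (<-trans i<j (toℕ<n j))
      from : (∀ j → clearedEarlier (toℕ j) ∩ contaminated (toℕ j) ⊆ S σ j) → Monotone σ
      from guarded v k j c k<j z = guarded j (x∈p∩q⁺ (early , cont))
        where
        early : v ∈ clearedEarlier (toℕ j)
        early = Equivalence.from (∈-clearedEarlier⇔ (toℕ j)) (toℕ k , k<j , Equivalence.to (Cleared⇔Clears k) c)
        cont : v ∈ contaminated (toℕ j)
        cont = Equivalence.from (∈-contaminated⇔ (toℕ j)) (subst (λ t → Zℕ σ t v) (toℕ-inject₁ j) z)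

  Allowed : Bool → ℕ → State → Subset (n G) → Set
  Allowed mono k (Z , D , _) S = Nonempty S × ∣ S ∣ ≤ k × (T mono → D ∩ Z ⊆ S)

  allowed? : ∀ mono k s S → Dec (Allowed mono k s S)
  allowed? mono k (Z , D , _) S = nonempty? S ×-dec ∣ S ∣ ≤? k ×-dec (T? mono →-dec (D ∩ Z) ⊆? S)

  Final : State → Set
  Final (Z , _ , _) = Empty Z

  final? : ∀ s → Dec (Final s)
  final? (Z , _ , _) = ¬? (nonempty? Z)

  states : List State
  states = cartesianProduct (allSubsets _) (cartesianProduct (allSubsets _) (allSubsets _))

  ∈-states : ∀ s → s List.∈ states
  ∈-states (Z , D , P) = ∈-cartesianProduct⁺ (∈-allSubsets Z) (∈-cartesianProduct⁺ (∈-allSubsets D) (∈-allSubsets P))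

  _≟ₛ_ : DecidableEquality State
  _≟ₛ_ = Product.≡-dec ≟Subset (Product.≡-dec ≟Subset ≟Subset)
    where
    ≟Subset : DecidableEquality (Subset (n G))
    ≟Subset = Vec.≡-dec _≟ᵇ_

  Admissible : Bool → Strategy G → Set
  Admissible mono σ = Winning σ × (T mono → Monotone σ)

  module _ (mono : Bool) (k : ℕ) where
    open Reachability _≟ₛ_ states ∈-states anySubset? step (allowed? mono k) final?

    admissible⇔path : ∀ σ → (Admissible mono σ × hunters σ ≤ k) ⇔ IndexedPath start (len σ) (moves σ)
    admissible⇔path σ = mk⇔ to from
      where
      open Trace σ
      open Contamination σ using (winning⇔uncontaminated)
      AllowedAt : ℕ → Subset (n G) → Set
      AllowedAt m = Allowed mono k (state m)
      to : Admissible mono σ × hunters σ ≤ k → IndexedPath start (len σ) (moves σ)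
      to ((win , mono⇒) , few) = Equivalence.from (∀<⇔∀Fin (λ m → AllowedAt m (moves σ m))) allowed , final
        where
        allowed : ∀ j → AllowedAt (toℕ j) (moves σ (toℕ j))
        allowed j = subst (AllowedAt (toℕ j)) (sym (moves-toℕ σ j))
          (nonempty σ j , Equivalence.to (maxOver-≤⇔ _) few j , λ t → Equivalence.to monotone⇔ (mono⇒ t) j)
        final : Empty (contaminated (len σ))
        final (x , x∈) = Equivalence.to winning⇔uncontaminated win x (Equivalence.to (∈-contaminated⇔ (len σ)) x∈)
      from : IndexedPath start (len σ) (moves σ) → Admissible mono σ × hunters σ ≤ k
      from (allowed , final) =
        (Equivalence.from winning⇔uncontaminated
           (λ x z → final (x , Equivalence.from (∈-contaminated⇔ (len σ)) z)) ,
         λ t → Equivalence.from monotone⇔ (λ j → proj₂ (proj₂ (allowed′ j)) t)) ,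
        Equivalence.from (maxOver-≤⇔ _) (λ j → proj₁ (proj₂ (allowed′ j)))
        where
        allowed′ : ∀ j → AllowedAt (toℕ j) (S σ j)
        allowed′ j = subst (AllowedAt (toℕ j)) (moves-toℕ σ j)
          (Equivalence.to (∀<⇔∀Fin (λ m → AllowedAt m (moves σ m))) allowed j)

    admissible? : Dec (Σ (Strategy G) λ σ → Admissible mono σ × hunters σ ≤ k)
    admissible? = map′ fromPath toPath (path? start)
      where
      fromPath : ∃ (Path start) → Σ (Strategy G) λ σ → Admissible mono σ × hunters σ ≤ k
      fromPath (ls , p) = σ , Equivalence.from (admissible⇔path σ) indexed
        where
        indexed : IndexedPath start (length ls) (atℕ (lookup ls) full)
        indexed = Equivalence.to (Path-tabulate⇔IndexedPath start (lookup ls) full)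
                    (subst (Path start) (sym (tabulate-lookup ls)) p)
        σ : Strategy G
        σ = record
          { len = length ls
          ; S = lookup ls
          ; nonempty = λ j → subst Nonempty (atℕ-toℕ (lookup ls) full j) (proj₁ (proj₁ indexed (toℕ j) (toℕ<n j)))
          }
      toPath : (Σ (Strategy G) λ σ → Admissible mono σ × hunters σ ≤ k) → ∃ (Path start)
      toPath (σ , admissible) =
        tabulate (S σ) ,
        Equivalence.from (Path-tabulate⇔IndexedPath start (S σ) full) (Equivalence.to (admissible⇔path σ) admissible)

open Hunting

⁅x⁆-clique : (G : Graph) (x : Fin (n G)) → IsClique G ⁅ x ⁆
⁅x⁆-clique G x y z y∈ z∈ y≢z = ⊥-elim (y≢z (trans (x∈⁅y⁆⇒x≡y x y∈) (sym (x∈⁅y⁆⇒x≡y x z∈))))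

maximal-clique-nonempty : ∀ {G} {C : Subset (n G)} → Fin (n G) → IsMaximalClique G C → Nonempty C
maximal-clique-nonempty {G} {C} x (_ , maximal) with nonempty? C
... | yes C≢∅ = C≢∅
... | no C≡∅ = ⊥-elim (C≡∅ (x , maximal ⁅ x ⁆ (⁅x⁆-clique G x) (λ y∈C → ⊥-elim (C≡∅ (_ , y∈C))) (x∈⁅x⁆ x)))

twice : (G : Graph) {C : Subset (n G)} → Nonempty C → Strategy G
twice G {C} C≢∅ = record { len = 2 ; S = λ _ → C ; nonempty = λ _ → C≢∅ }

hunters-twice : ∀ {G} {C : Subset (n G)} (C≢∅ : Nonempty C) → hunters (twice G C≢∅) ≡ ∣ C ∣
hunters-twice {C = C} _ = trans (cong (∣ C ∣ ⊔_) (⊔-identityʳ ∣ C ∣)) (⊔-idem ∣ C ∣)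

twice-winning : ∀ {G} {C I : Subset (n G)} (C≢∅ : Nonempty C) →
                IsPartition G C I → IsIndependent G I → Winning (twice G C≢∅)
twice-winning _ partition independent r walk with proj₁ (partition (r zero)) | proj₁ (partition (r (suc zero)))
... | inj₁ r₀∈C | _ = zero , r₀∈C
... | inj₂ _ | inj₁ r₁∈C = suc zero , r₁∈C
... | inj₂ r₀∈I | inj₂ r₁∈I = ⊥-elim (independent _ _ r₀∈I r₁∈I (walk zero))

twice-monotone : ∀ {G} {C : Subset (n G)} (C≢∅ : Nonempty C) → Monotone (twice G C≢∅)
twice-monotone _ v k zero _ ()
twice-monotone _ v k (suc zero) _ (s≤s ())

module _ {G : Graph} where

  Optimal : (Strategy G → Set) → ℕ → Set
  Optimal P k = (Σ (Strategy G) λ σ → P σ × hunters σ ≡ k) × (∀ σ → P σ → k ≤ hunters σ)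

  optimal-antitone : ∀ {P Q : Strategy G → Set} {a b} → (∀ σ → P σ → Q σ) → Optimal Q a → Optimal P b → a ≤ b
  optimal-antitone P⇒Q (_ , minimal) ((σ , Pσ , ≡b) , _) = subst (_ ≤_) ≡b (minimal σ (P⇒Q σ Pσ))

  optimal-pinned : ∀ {P : Strategy G → Set} c →
    (∀ σ → P σ → c ∸ 1 ≤ hunters σ) → (Σ (Strategy G) λ σ → P σ × hunters σ ≡ c) →
    Dec (Σ (Strategy G) λ σ → P σ × hunters σ ≤ c ∸ 1) →
    ∃ λ k → Optimal P k × c ∸ 1 ≤ k × k ≤ c
  optimal-pinned c lower _ (yes (σ , Pσ , ≤c∸1)) =
    c ∸ 1 , ((σ , Pσ , ≤-antisym ≤c∸1 (lower σ Pσ)) , lower) , ≤-refl , m∸n≤m c 1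
  optimal-pinned {P} c _ attained (no none) = c , (attained , minimal) , m∸n≤m c 1 , ≤-refl
    where
    minimal : ∀ σ → P σ → c ≤ hunters σ
    minimal σ Pσ = ≮⇒≥ (λ <c → none (σ , Pσ , <⇒≤∸1 <c))
      where
      <⇒≤∸1 : ∀ {m c} → m < c → m ≤ c ∸ 1
      <⇒≤∸1 (s≤s m≤c) = m≤c

module _ {G : Graph} where
  open Encoding G using (Admissible; admissible?)

  hunter-number : ∀ {k} → ¬ n G ≡ 1 → Optimal (Admissible false) k → IsHunterNumber G k
  hunter-number n≢1 ((σ , (win , _) , ≡k) , minimal) =
    inj₂ (n≢1 , (σ , win , ≡k) , λ σ win → minimal σ (win , λ ()))

  monotone-hunter-number : ∀ {k} → ¬ n G ≡ 1 → Optimal (Admissible true) k → IsMonotoneHunterNumber G k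
  monotone-hunter-number n≢1 ((σ , (win , mono) , ≡k) , minimal) =
    inj₂ (n≢1 , (σ , win , mono _ , ≡k) , λ σ win mono → minimal σ (win , λ _ → mono))

  split-graph-optimal : ∀ {C I : Subset (n G)} → Connected G → IsPartition G C I →
    IsMaximalClique G C → IsIndependent G I →
    ∀ mono → ∃ λ k → Optimal (Admissible mono) k × ∣ C ∣ ∸ 1 ≤ k × k ≤ ∣ C ∣
  split-graph-optimal {C} ((x , _) , _) partition maximal independent mono =
    optimal-pinned {P = Admissible mono} ∣ C ∣ (λ σ (win , _) → clique-bound {G} (proj₁ maximal) σ win)
      (twice G C≢∅ , (twice-winning {G} C≢∅ partition independent , λ _ → twice-monotone C≢∅) , hunters-twice {G} C≢∅)
      (admissible? mono (∣ C ∣ ∸ 1))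
    where
    C≢∅ : Nonempty C
    C≢∅ = maximal-clique-nonempty {G} x maximal

proposition4p2 : (G : Graph) (C I : Subset (n G)) → Connected G →
    IsPartition G C I → IsMaximalClique G C → IsIndependent G I →
    Σ ℕ λ h → Σ ℕ λ mh → IsHunterNumber G h × IsMonotoneHunterNumber G mh ×
      (∣ C ∣ ∸ 1 ≤ h) × (h ≤ mh) × (mh ≤ ∣ C ∣)
proposition4p2 G C I connected partition maximal independent
  with n G ≟ 1 | split-graph-optimal connected partition maximal independent false
               | split-graph-optimal connected partition maximal independent true
... | yes n≡1 | _ | _ =
  0 , 0 , inj₁ (n≡1 , refl) , inj₁ (n≡1 , refl) , ∸-monoˡ-≤ 1 (subst (∣ C ∣ ≤_) n≡1 (∣p∣≤n C)) , z≤n , z≤n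
... | no n≢1 | h , optimal-h , ∣C∣∸1≤h , _ | mh , optimal-mh , _ , mh≤∣C∣ =
  h , mh , hunter-number n≢1 optimal-h , monotone-hunter-number n≢1 optimal-mh ,
  ∣C∣∸1≤h , optimal-antitone (λ _ (win , _) → win , λ ()) optimal-h optimal-mh , mh≤∣C∣
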